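{- Let $q\ge 5$ be a prime power. In $\mathrm{AG}(2,q)$ there exists a minimal blocking set of size $k$ for every integer $k$ with $2q-1\le k\le 3q-6$.
   Context: $\mathrm{AG}(2,q)$ is the affine plane of order $q$. A blocking set of $\mathrm{AG}(2,q)$ is a set of points meeting every line of $\mathrm{AG}(2,q)$ (it may contain lines); it is minimal if no proper subset is a blocking set. -}

module Defs where

open import Data.Nat using (ℕ; suc; _^_)
open import Data.Nat.Primality using (Prime)
open import Data.Fin using (Fin)
open import Data.Bool using (Bool; true; false)
open import Data.List using (List; length; filter)
open import Data.Fin.Base using ()
open import Data.Vec.Functional using ()
open import Data.List using (allFin; cartesianProduct)
open import Data.Product using (Σ; ∃; ∃-syntax; _×_; _,_)
open import Relation.Binary.PropositionalEquality using (_≡_)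
open import Relation.Nullary using (¬_)
open import Algebra.Structures using (IsCommutativeRing)

IsPrimePower : ℕ → Set
IsPrimePower q = Σ ℕ λ p → Σ ℕ λ e → Prime p × (q ≡ p ^ suc e)

-- A field structure on the finite set Fin q (so a field of order q),
-- with propositional equality.
record FieldOn (q : ℕ) : Set where
  field
    _+_ _*_ : Fin q → Fin q → Fin q
    -_      : Fin q → Fin q
    0# 1#   : Fin q
    isCommutativeRing : IsCommutativeRing _≡_ _+_ _*_ -_ 0# 1#
    0≢1     : ¬ (0# ≡ 1#)
    inv     : (x : Fin q) → ¬ (x ≡ 0#) → Σ (Fin q) λ y → x * y ≡ 1#

module AG2 {q : ℕ} (F : FieldOn q) where
  open FieldOn F

  Point : Set
  Point = Fin q × Fin q

  data Line : Set where
    nonVertical : (m b : Fin q) → Line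
    vertical    : (c : Fin q) → Line

  _∈L_ : Point → Line → Set
  (x , y) ∈L nonVertical m b = y ≡ (m * x) + b
  (x , y) ∈L vertical c      = x ≡ c

  PointSet : Set
  PointSet = Point → Bool

  allPoints : List Point
  allPoints = cartesianProduct (allFin q) (allFin q)

  size : PointSet → ℕ
  size B = length (filter (λ p → B p Data.Bool.≟ true) allPoints)

  IsBlockingSet : PointSet → Set
  IsBlockingSet B = (ℓ : Line) → Σ Point λ p → (p ∈L ℓ) × (B p ≡ true)

  _⊂_ : PointSet → PointSet → Set
  S ⊂ B = ((p : Point) → S p ≡ true → B p ≡ true)
          × (Σ Point λ p → (B p ≡ true) × (S p ≡ false))

  IsMinimalBlockingSet : PointSet → Set
  IsMinimalBlockingSet B =
    IsBlockingSet B × ((S : PointSet) → S ⊂ B → ¬ IsBlockingSet S)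

{-# OPTIONS --safe #-}
module Submission where

-- Let S be a set of slopes avoiding 0, 1 and some further z. Take B to consist of the points
-- (0, y) and (1, y) with y ≠ 0, except (1, m) for m ∈ S, and of one point on every other
-- column X = x: the point (x, x − 1) if the line joining it to the origin has slope in S, and
-- (x, 0) otherwise. A line Y = mX is then blocked at (1, m) or, for m ∈ S, on the line
-- Y = X − 1; the line Y = 0 is blocked at (x, 0) where (x, x − 1) has slope z. So B is
-- blocking, of size 3q − 4 − |S|. Every point of B has a tangent line: X = x for the single
-- points, Y = yX for (1, y), the line to (1, 0) for (0, b) with b ≠ −1, and the line to (1, s)
-- for (0, −1), where s ∈ S must satisfy s = −1 or −s ∈ S (the latter is automatic in
-- characteristic 2). Growing S one element at a time from {s} to everything but 0, 1, z gives
-- every size from 2q − 1 to 3q − 5.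

module Counting where

  open import Data.Bool using (Bool; true; false; not; _∧_; _∨_)
  import Data.Bool as Bool
  open import Data.List using (List; []; _∷_; _++_; length; filter; allFin; cartesianProduct)
  import Data.List as List
  open import Data.List.Properties using (map-++; map-∘; map-tabulate; map-cong)
  open import Data.Nat.ListAction using () renaming (sum to sumᴸ)
  open import Data.Nat.ListAction.Properties using (sum-++)
  open import Function using (id)
  open import Data.Bool.Properties
    using (T-≡; ∨-conicalˡ; ∨-conicalʳ; ∨-zeroʳ; ∧-zeroʳ; ∧-identityʳ; ¬-not)
  open import Data.Fin using (Fin; zero; suc; toℕ)
  open import Data.Fin.Properties using (_≟_; ¬∀⟶∃¬; toℕ<n)
  open import Function.Bundles using (Equivalence)
  open import Data.Nat using (ℕ; zero; suc; _+_; _*_; _≤_; _<_; _<ᵇ_; _≡ᵇ_; z≤n; s≤s)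
  open import Data.Nat.Properties
    using (<⇒<ᵇ; +-mono-≤; +-monoʳ-≤; +-comm; +-identityʳ; ≤-refl; ≤-trans; ≤-reflexive; <-irrefl;
           module ≤-Reasoning)
  import Data.Nat.Properties as ℕ
  open import Data.Product using (∃; _×_; _,_)
  open import Relation.Binary.PropositionalEquality
    using (_≡_; _≢_; refl; sym; trans; cong; cong₂; module ≡-Reasoning)
  open import Relation.Nullary using (¬_; does; yes; no; contradiction)
  open import Relation.Nullary.Decidable using (dec-true; dec-false)
  open import Algebra.Properties.Semiring.Sum ℕ.+-*-semiring
    using (sum; sum-syntax; ∑-distrib-+; sum-cong-≗; *-distribʳ-sum)

  [_] : Bool → ℕ
  [ true ]  = 1
  [ false ] = 0

  count : ∀ {n} → (Fin n → Bool) → ℕ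
  count {n} P = ∑[ i < n ] [ P i ]

  _==_ : ∀ {n} → Fin n → Fin n → Bool
  i == j = does (i ≟ j)

  ==-refl : ∀ {n} (i : Fin n) → i == i ≡ true
  ==-refl i = dec-true (i ≟ i) refl

  ==-false : ∀ {n} {i j : Fin n} → i ≢ j → i == j ≡ false
  ==-false = dec-false (_ ≟ _)

  ==⇒≡ : ∀ {n} {i j : Fin n} → i == j ≡ true → i ≡ j
  ==⇒≡ {i = i} {j} i==j with i ≟ j
  ... | yes i≡j = i≡j

  ==-false⇒≢ : ∀ {n} {i j : Fin n} → i == j ≡ false → i ≢ j
  ==-false⇒≢ {i = i} i==j≡false refl = contradiction (trans (sym (==-refl i)) i==j≡false) λ ()

  ∑-mono-≤ : ∀ {n} {f g : Fin n → ℕ} → (∀ i → f i ≤ g i) → sum f ≤ sum g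
  ∑-mono-≤ {zero}  f≤g = z≤n
  ∑-mono-≤ {suc n} f≤g = +-mono-≤ (f≤g zero) (∑-mono-≤ (λ i → f≤g (suc i)))

  count-cong : ∀ {n} {P Q : Fin n → Bool} → (∀ i → P i ≡ Q i) → count P ≡ count Q
  count-cong P≗Q = sum-cong-≗ (λ i → cong [_] (P≗Q i))

  count-mono : ∀ {n} {P Q : Fin n → Bool} → (∀ i → P i ≡ true → Q i ≡ true) → count P ≤ count Q
  count-mono {P = P} {Q} P⊆Q = ∑-mono-≤ (λ i → mono (P i) (Q i) (P⊆Q i))
    where
    mono : ∀ a b → (a ≡ true → b ≡ true) → [ a ] ≤ [ b ]
    mono false b _  = z≤n
    mono true  b a⇒b rewrite a⇒b refl = ≤-refl

  count-true : ∀ n → count {n} (λ _ → true) ≡ n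
  count-true zero    = refl
  count-true (suc n) = cong suc (count-true n)

  count-false : ∀ n → count {n} (λ _ → false) ≡ 0
  count-false zero    = refl
  count-false (suc n) = count-false n

  count-== : ∀ {n} (j : Fin n) → count (_== j) ≡ 1
  count-== {suc n} zero    = cong suc (count-false n)
  count-== {suc n} (suc j) = count-== j

  count-∨ : ∀ {n} (P Q : Fin n → Bool) → count (λ i → P i ∨ Q i) ≤ count P + count Q
  count-∨ P Q = ≤-trans (∑-mono-≤ (λ i → ∨-bound (P i) (Q i)))
                        (≤-reflexive (∑-distrib-+ (λ i → [ P i ]) (λ i → [ Q i ])))
    where
    ∨-bound : ∀ a b → [ a ∨ b ] ≤ [ a ] + [ b ]
    ∨-bound true  b = s≤s z≤n
    ∨-bound false b = ≤-refl

  count-∨-disjoint : ∀ {n} (P Q : Fin n → Bool) → (∀ i → P i ∧ Q i ≡ false) →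
                     count (λ i → P i ∨ Q i) ≡ count P + count Q
  count-∨-disjoint P Q disjoint =
    trans (sum-cong-≗ (λ i → ∨-exact (P i) (Q i) (disjoint i)))
          (∑-distrib-+ (λ i → [ P i ]) (λ i → [ Q i ]))
    where
    ∨-exact : ∀ a b → a ∧ b ≡ false → [ a ∨ b ] ≡ [ a ] + [ b ]
    ∨-exact true  false _ = refl
    ∨-exact false b     _ = refl

  count-not : ∀ {n} (P : Fin n → Bool) → count (λ i → not (P i)) + count P ≡ n
  count-not {n} P = trans (sym (∑-distrib-+ (λ i → [ not (P i) ]) (λ i → [ P i ])))
                          (trans (sum-cong-≗ (λ i → not-exact (P i))) (count-true n))
    where
    not-exact : ∀ a → [ not a ] + [ a ] ≡ [ true ]
    not-exact true  = refl
    not-exact false = refl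

  ∃-outside : ∀ {n} (P : Fin n → Bool) → count P < n → ∃ λ i → P i ≡ false
  ∃-outside {n} P count<n with ¬∀⟶∃¬ n (λ i → P i ≡ true) (λ i → P i Bool.≟ true) ¬all-true
    where
    ¬all-true : ¬ ∀ i → P i ≡ true
    ¬all-true all = <-irrefl (trans (count-cong all) (count-true n)) count<n
  ... | i , Pi≢true = i , ¬-not Pi≢true

  count-toℕ≡ᵇ≤1 : ∀ {n} t → count {n} (λ i → toℕ i ≡ᵇ t) ≤ 1
  count-toℕ≡ᵇ≤1 {zero}  t       = z≤n
  count-toℕ≡ᵇ≤1 {suc n} zero    = ≤-reflexive (cong suc (count-false n))
  count-toℕ≡ᵇ≤1 {suc n} (suc t) = count-toℕ≡ᵇ≤1 {n} t

  ∑-two-exceptions : ∀ {n} {a b : Fin n} (f : Fin n → ℕ) → a ≢ b →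
                     (∀ i → i ≢ a → i ≢ b → f i ≡ 1) → sum f + 2 ≡ f a + f b + n
  ∑-two-exceptions {n} {a} {b} f a≢b f≡1 = begin
      sum f + 2
    ≡⟨ cong (sum f +_) (cong₂ _+_ (count-== a) (count-== b)) ⟨
      sum f + (count (_== a) + count (_== b))
    ≡⟨ cong (sum f +_) (∑-distrib-+ (λ i → [ i == a ]) (λ i → [ i == b ])) ⟨
      sum f + ∑[ i < n ] ([ i == a ] + [ i == b ])
    ≡⟨ ∑-distrib-+ f (λ i → [ i == a ] + [ i == b ]) ⟨
      ∑[ i < n ] (f i + ([ i == a ] + [ i == b ]))
    ≡⟨ sum-cong-≗ pointwise ⟩
      ∑[ i < n ] ([ i == a ] * f a + [ i == b ] * f b + 1)
    ≡⟨ ∑-distrib-+ (λ i → [ i == a ] * f a + [ i == b ] * f b) (λ _ → 1) ⟩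
      ∑[ i < n ] ([ i == a ] * f a + [ i == b ] * f b) + ∑[ i < n ] 1
    ≡⟨ cong₂ _+_ (∑-distrib-+ (λ i → [ i == a ] * f a) (λ i → [ i == b ] * f b)) (count-true n) ⟩
      ∑[ i < n ] ([ i == a ] * f a) + ∑[ i < n ] ([ i == b ] * f b) + n
    ≡⟨ cong (_+ n) (cong₂ _+_ (weighted a (f a)) (weighted b (f b))) ⟩
      f a + f b + n
    ∎
    where
    open ≡-Reasoning
    weighted : ∀ c m → ∑[ i < n ] ([ i == c ] * m) ≡ m
    weighted c m = trans (sym (*-distribʳ-sum m (λ i → [ i == c ])))
                         (trans (cong (_* m) (count-== c)) (+-identityʳ m))
    pointwise : ∀ i → f i + ([ i == a ] + [ i == b ]) ≡ [ i == a ] * f a + [ i == b ] * f b + 1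
    pointwise i with i ≟ a | i ≟ b
    ... | yes refl | yes refl = contradiction refl a≢b
    ... | yes refl | no _     = cong (_+ 1) (sym (trans (+-identityʳ (f a + 0)) (+-identityʳ (f a))))
    ... | no _     | yes refl = cong (_+ 1) (sym (+-identityʳ (f b)))
    ... | no i≢a   | no i≢b   = trans (+-identityʳ (f i)) (f≡1 i i≢a i≢b)

  ∈｛_,_,_｝ : ∀ {n} → Fin n → Fin n → Fin n → Fin n → Bool
  ∈｛ a , b , c ｝ i = i == a ∨ (i == b ∨ i == c)

  count-∈｛｝≤3 : ∀ {n} (a b c : Fin n) → count ∈｛ a , b , c ｝ ≤ 3
  count-∈｛｝≤3 a b c = begin
    count ∈｛ a , b , c ｝
      ≤⟨ count-∨ (_== a) (λ i → i == b ∨ i == c) ⟩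
    count (_== a) + count (λ i → i == b ∨ i == c)
      ≤⟨ +-monoʳ-≤ (count (_== a)) (count-∨ (_== b) (_== c)) ⟩
    count (_== a) + (count (_== b) + count (_== c))
      ≡⟨ cong₂ _+_ (count-== a) (cong₂ _+_ (count-== b) (count-== c)) ⟩
    3 ∎
    where open ≤-Reasoning

  ∈｛｝-first : ∀ {n} (a b c : Fin n) → ∈｛ a , b , c ｝ a ≡ true
  ∈｛｝-first a b c rewrite ==-refl a = refl

  ∈｛｝-second : ∀ {n} (a b c : Fin n) → ∈｛ a , b , c ｝ b ≡ true
  ∈｛｝-second a b c rewrite ==-refl b = ∨-zeroʳ (b == a)

  ∈｛｝-third : ∀ {n} (a b c : Fin n) → ∈｛ a , b , c ｝ c ≡ true
  ∈｛｝-third a b c rewrite ==-refl c | ∨-zeroʳ (c == b) = ∨-zeroʳ (c == a)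

  ∉｛｝ : ∀ {n} {a b c i : Fin n} → i ≢ a → i ≢ b → i ≢ c → ∈｛ a , b , c ｝ i ≡ false
  ∉｛｝ i≢a i≢b i≢c rewrite ==-false i≢a | ==-false i≢b | ==-false i≢c = refl

  count-∈｛｝ : ∀ {n} {a b c : Fin n} → a ≢ b → a ≢ c → b ≢ c → count ∈｛ a , b , c ｝ ≡ 3
  count-∈｛｝ {a = a} {b} {c} a≢b a≢c b≢c = begin
    count ∈｛ a , b , c ｝
      ≡⟨ count-∨-disjoint (_== a) (λ i → i == b ∨ i == c) a∉bc ⟩
    count (_== a) + count (λ i → i == b ∨ i == c)
      ≡⟨ cong (count (_== a) +_) (count-∨-disjoint (_== b) (_== c) b∉c) ⟩
    count (_== a) + (count (_== b) + count (_== c))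
      ≡⟨ cong₂ _+_ (count-== a) (cong₂ _+_ (count-== b) (count-== c)) ⟩
    3 ∎
    where
    open ≡-Reasoning
    a∉bc : ∀ i → i == a ∧ (i == b ∨ i == c) ≡ false
    a∉bc i with i ≟ a
    ... | yes refl rewrite ==-false a≢b | ==-false a≢c = refl
    ... | no _ = refl
    b∉c : ∀ i → i == b ∧ i == c ≡ false
    b∉c i with i ≟ b
    ... | yes refl = ==-false b≢c
    ... | no _ = refl

  ∃-avoiding-three : ∀ {n} → 4 ≤ n → (a b c : Fin n) → ∃ λ i → i ≢ a × i ≢ b × i ≢ c
  ∃-avoiding-three 4≤n a b c
    with ∃-outside ∈｛ a , b , c ｝ (≤-trans (s≤s (count-∈｛｝≤3 a b c)) 4≤n)
  ... | i , i∉abc = i , ==-false⇒≢ (∨-conicalˡ (i == a) _ i∉abc)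
                      , ==-false⇒≢ (∨-conicalˡ (i == b) _ i∉bc)
                      , ==-false⇒≢ (∨-conicalʳ (i == b) _ i∉bc)
    where
    i∉bc : i == b ∨ i == c ≡ false
    i∉bc = ∨-conicalʳ (i == a) (i == b ∨ i == c) i∉abc

  module Segments {n} (E : Fin n → Bool) (s : Fin n) where

    segment : ℕ → Fin n → Bool
    segment t i = not (E i) ∧ (i == s ∨ (toℕ i <ᵇ t))

    segment-∉ : ∀ t i → E i ≡ true → segment t i ≡ false
    segment-∉ t i Ei≡true rewrite Ei≡true = refl

    segment-∋s : ∀ t → E s ≡ false → segment t s ≡ true
    segment-∋s t Es≡false rewrite Es≡false | ==-refl s = refl

    count-segment-zero : E s ≡ false → count (segment 0) ≡ 1
    count-segment-zero Es≡false = trans (count-cong pointwise) (count-== s)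
      where
      pointwise : ∀ i → segment 0 i ≡ i == s
      pointwise i with i ≟ s
      ... | yes refl rewrite Es≡false = refl
      ... | no _ = ∧-zeroʳ (not (E i))

    count-segment-suc : ∀ t → count (segment (suc t)) ≤ suc (count (segment t))
    count-segment-suc t = begin
      count (segment (suc t))
        ≤⟨ count-mono grows-by-index-t ⟩
      count (λ i → segment t i ∨ (toℕ i ≡ᵇ t))
        ≤⟨ count-∨ (segment t) (λ i → toℕ i ≡ᵇ t) ⟩
      count (segment t) + count {n} (λ i → toℕ i ≡ᵇ t)
        ≤⟨ +-monoʳ-≤ (count (segment t)) (count-toℕ≡ᵇ≤1 {n} t) ⟩
      count (segment t) + 1
        ≡⟨ +-comm (count (segment t)) 1 ⟩
      suc (count (segment t)) ∎
      where
      open ≤-Reasoning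
      <ᵇ-suc : ∀ m t → (m <ᵇ suc t) ≡ ((m <ᵇ t) ∨ (m ≡ᵇ t))
      <ᵇ-suc zero    zero    = refl
      <ᵇ-suc zero    (suc t) = refl
      <ᵇ-suc (suc m) zero    = refl
      <ᵇ-suc (suc m) (suc t) = <ᵇ-suc m t
      weaken : ∀ a b c d → a ∧ (b ∨ (c ∨ d)) ≡ true → a ∧ (b ∨ c) ∨ d ≡ true
      weaken true true  c     d    _ = refl
      weaken true false true  d    _ = refl
      weaken true false false true _ = refl
      grows-by-index-t : ∀ i → segment (suc t) i ≡ true → segment t i ∨ (toℕ i ≡ᵇ t) ≡ true
      grows-by-index-t i rewrite <ᵇ-suc (toℕ i) t =
        weaken (not (E i)) (i == s) (toℕ i <ᵇ t) (toℕ i ≡ᵇ t)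

    count-segment-n : count (segment n) + count E ≡ n
    count-segment-n = trans (cong (_+ count E) (count-cong pointwise)) (count-not E)
      where
      pointwise : ∀ i → segment n i ≡ not (E i)
      pointwise i rewrite Equivalence.to T-≡ (<⇒<ᵇ (toℕ<n i)) | ∨-zeroʳ (i == s) =
        ∧-identityʳ (not (E i))

  module _ {A : Set} where

    length-filter≡sum : (P : A → Bool) (xs : List A) →
                        length (filter (λ a → P a Bool.≟ true) xs) ≡ sumᴸ (List.map (λ a → [ P a ]) xs)
    length-filter≡sum P []       = refl
    length-filter≡sum P (x ∷ xs) with P x
    ... | true  = cong suc (length-filter≡sum P xs)
    ... | false = length-filter≡sum P xs

    sum-cartesianProduct : ∀ {B : Set} (h : A × B → ℕ) xs ys →
      sumᴸ (List.map h (cartesianProduct xs ys))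
        ≡ sumᴸ (List.map (λ x → sumᴸ (List.map (λ y → h (x , y)) ys)) xs)
    sum-cartesianProduct h []       ys = refl
    sum-cartesianProduct h (x ∷ xs) ys = begin
      sumᴸ (List.map h (List.map (x ,_) ys ++ cartesianProduct xs ys))
        ≡⟨ cong sumᴸ (map-++ h (List.map (x ,_) ys) (cartesianProduct xs ys)) ⟩
      sumᴸ (List.map h (List.map (x ,_) ys) ++ List.map h (cartesianProduct xs ys))
        ≡⟨ sum-++ (List.map h (List.map (x ,_) ys)) (List.map h (cartesianProduct xs ys)) ⟩
      sumᴸ (List.map h (List.map (x ,_) ys)) + sumᴸ (List.map h (cartesianProduct xs ys))
        ≡⟨ cong₂ _+_ (cong sumᴸ (sym (map-∘ ys))) (sum-cartesianProduct h xs ys) ⟩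
      sumᴸ (List.map (λ y → h (x , y)) ys)
        + sumᴸ (List.map (λ x → sumᴸ (List.map (λ y → h (x , y)) ys)) xs) ∎
      where open ≡-Reasoning

  sum-map-allFin : ∀ {n} (g : Fin n → ℕ) → sumᴸ (List.map g (allFin n)) ≡ ∑[ i < n ] g i
  sum-map-allFin {n} g = trans (cong sumᴸ (map-tabulate id g)) (sum-tabulate g)
    where
    sum-tabulate : ∀ {m} (g : Fin m → ℕ) → sumᴸ (List.tabulate g) ≡ ∑[ i < m ] g i
    sum-tabulate {zero}  g = refl
    sum-tabulate {suc m} g = cong (g zero +_) (sum-tabulate (λ i → g (suc i)))

  count-cartesianProduct : ∀ {m n} (P : Fin m × Fin n → Bool) →
    length (filter (λ p → P p Bool.≟ true) (cartesianProduct (allFin m) (allFin n)))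
      ≡ ∑[ x < m ] count (λ y → P (x , y))
  count-cartesianProduct {m} {n} P = begin
    length (filter (λ p → P p Bool.≟ true) (cartesianProduct (allFin m) (allFin n)))
      ≡⟨ length-filter≡sum P (cartesianProduct (allFin m) (allFin n)) ⟩
    sumᴸ (List.map (λ p → [ P p ]) (cartesianProduct (allFin m) (allFin n)))
      ≡⟨ sum-cartesianProduct (λ p → [ P p ]) (allFin m) (allFin n) ⟩
    sumᴸ (List.map (λ x → sumᴸ (List.map (λ y → [ P (x , y) ]) (allFin n))) (allFin m))
      ≡⟨ cong sumᴸ (map-cong (λ x → sum-map-allFin (λ y → [ P (x , y) ])) (allFin m)) ⟩
    sumᴸ (List.map (λ x → count (λ y → P (x , y))) (allFin m))
      ≡⟨ sum-map-allFin (λ x → count (λ y → P (x , y))) ⟩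
    ∑[ x < m ] count (λ y → P (x , y))
      ∎
    where open ≡-Reasoning

module Arithmetic where

  open import Data.Nat using (ℕ; zero; suc; _+_; _*_; _∸_; _≤_; _≤?_; z≤n; s≤s)
  open import Data.Nat.Properties
    using (≤-antisym; ≤-trans; ≤-reflexive; ≰⇒>; m≤m+n; *-monoʳ-≤; +-monoˡ-≤; +-monoʳ-≤;
           +-cancelʳ-≤; m∸n+n≡m; m≤n⇒∃[o]m+o≡n; module ≤-Reasoning)
  open import Data.Nat.Tactic.RingSolver using (solve-∀)
  open import Data.Product using (∃; _×_; _,_)
  open import Relation.Binary.PropositionalEquality using (_≡_; sym; trans)
  open import Relation.Nullary using (yes; no)

  intermediateValue : (c : ℕ → ℕ) → (∀ t → c (suc t) ≤ suc (c t)) →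
                      ∀ {n} T → c 0 ≤ n → n ≤ c T → ∃ λ t → c t ≡ n
  intermediateValue c step zero    c0≤n n≤cT = 0 , ≤-antisym c0≤n n≤cT
  intermediateValue c step {n} (suc T) c0≤n n≤cT with n ≤? c T
  ... | yes n≤cT′ = intermediateValue c step T c0≤n n≤cT′
  ... | no n≰cT′  = suc T , ≤-antisym (≤-trans (step T) (≰⇒> n≰cT′)) n≤cT

  sizeParameter : ∀ {q k} → 5 ≤ q → 2 * q ∸ 1 ≤ k → k ≤ 3 * q ∸ 6 →
                  ∃ λ n → 1 ≤ n × n + 3 ≤ q × k + n + 4 ≡ 3 * q
  sizeParameter {q} {k} 5≤q lo hi with m≤n⇒∃[o]m+o≡n k+6≤3q
    where
    k+6≤3q : k + 6 ≤ 3 * q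
    k+6≤3q = ≤-trans (+-monoˡ-≤ 6 hi) (≤-reflexive (m∸n+n≡m (≤-trans (m≤m+n 6 9) (*-monoʳ-≤ 3 5≤q))))
  ... | d , k+6+d≡3q = 2 + d , s≤s z≤n , d+5≤q , trans (shuffle k d) k+6+d≡3q
    where
    shuffle : ∀ k d → k + (2 + d) + 4 ≡ k + 6 + d
    shuffle = solve-∀
    2q≤k+1 : 2 * q ≤ k + 1
    2q≤k+1 = ≤-trans (≤-reflexive (sym (m∸n+n≡m (≤-trans (m≤m+n 1 9) (*-monoʳ-≤ 2 5≤q)))))
                     (+-monoˡ-≤ 1 lo)
    d+5≤q : 2 + d + 3 ≤ q
    d+5≤q = +-cancelʳ-≤ (2 * q) (2 + d + 3) q (begin
      2 + d + 3 + 2 * q    ≤⟨ +-monoʳ-≤ (2 + d + 3) 2q≤k+1 ⟩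
      2 + d + 3 + (k + 1)  ≡⟨ regroup d k ⟩
      k + 6 + d            ≡⟨ k+6+d≡3q ⟩
      3 * q                ≡⟨ split q ⟩
      q + 2 * q            ∎)
      where
      open ≤-Reasoning
      regroup : ∀ d k → 2 + d + 3 + (k + 1) ≡ k + 6 + d
      regroup = solve-∀
      split : ∀ q → 3 * q ≡ q + 2 * q
      split = solve-∀

open import Defs
open Counting
open Arithmetic

open import Algebra.Bundles using (CommutativeRing)
import Algebra.Properties.Ring as RingProperties
open import Data.Bool using (Bool; true; false; not; _∧_; _∨_; if_then_else_)
open import Data.Bool.Properties using (not-injective; ∨-conicalˡ; ∨-conicalʳ)
open import Data.Fin using (Fin)
open import Data.Fin.Properties using (_≟_)
open import Data.Nat using (ℕ; _≤_) renaming (_+_ to _+ℕ_; _*_ to _*ℕ_)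
open import Data.Nat.Properties using (+-*-semiring; <⇒≤; +-cancelʳ-≤; +-cancelʳ-≡)
open import Data.Nat.Tactic.RingSolver using (solve-∀)
open import Algebra.Properties.Semiring.Sum +-*-semiring using (sum)
open import Data.Product using (Σ; ∃; ∃₂; _×_; _,_; proj₁; proj₂)
open import Data.Sum using (_⊎_; inj₁; inj₂; map₂)
open import Function using (_∘_)
open import Level using (0ℓ)
open import Relation.Binary.PropositionalEquality
  using (_≡_; _≢_; refl; sym; trans; cong; cong₂; subst; module ≡-Reasoning)
open import Relation.Nullary using (Dec; yes; no; contradiction)

module FieldProperties {q : ℕ} (F : FieldOn q) where

  commutativeRing : CommutativeRing 0ℓ 0ℓ
  commutativeRing = record { isCommutativeRing = FieldOn.isCommutativeRing F }

  open CommutativeRing commutativeRing public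
    using (_+_; _*_; -_; _-_; 0#; 1#; +-assoc; +-comm; +-identityˡ; +-identityʳ; -‿inverseˡ;
           -‿inverseʳ; *-assoc; *-comm; *-identityˡ; *-identityʳ; distribʳ; zeroˡ; zeroʳ)
  open RingProperties (CommutativeRing.ring commutativeRing) public
    using (-1*x≈-x; -‿involutive; -0#≈0#; x[y-z]≈xy-xz; [y-z]x≈yx-zx; x∙y⁻¹≈ε⇒x≈y; x≈z//y;
           //-rightDividesˡ; //-rightDividesʳ; +-identityˡ-unique; +-inverseʳ-unique)
  open FieldOn F public using (0≢1)
  open ≡-Reasoning

  1≢0 : 1# ≢ 0#
  1≢0 1≡0 = 0≢1 (sym 1≡0)

  _⁻¹ : Fin q → Fin q
  x ⁻¹ with x ≟ 0#
  ... | yes _  = 0#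
  ... | no x≢0 = proj₁ (FieldOn.inv F x x≢0)

  x*x⁻¹≡1 : ∀ {x} → x ≢ 0# → x * x ⁻¹ ≡ 1#
  x*x⁻¹≡1 {x} x≢0 with x ≟ 0#
  ... | yes x≡0  = contradiction x≡0 x≢0
  ... | no x≢0′ = proj₂ (FieldOn.inv F x x≢0′)

  x*y≡1⇒y≢0 : ∀ {x y} → x * y ≡ 1# → y ≢ 0#
  x*y≡1⇒y≢0 {x} xy≡1 refl = 0≢1 (trans (sym (zeroʳ x)) xy≡1)

  x*y≡0⇒x≡0⊎y≡0 : ∀ {x y} → x * y ≡ 0# → x ≡ 0# ⊎ y ≡ 0#
  x*y≡0⇒x≡0⊎y≡0 {x} {y} xy≡0 with x ≟ 0#
  ... | yes x≡0 = inj₁ x≡0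
  ... | no x≢0  = inj₂ (begin
    y               ≡⟨ *-identityˡ y ⟨
    1# * y          ≡⟨ cong (_* y) (trans (*-comm (x ⁻¹) x) (x*x⁻¹≡1 x≢0)) ⟨
    x ⁻¹ * x * y    ≡⟨ *-assoc (x ⁻¹) x y ⟩
    x ⁻¹ * (x * y)  ≡⟨ cong (x ⁻¹ *_) xy≡0 ⟩
    x ⁻¹ * 0#       ≡⟨ zeroʳ (x ⁻¹) ⟩
    0#              ∎)

  x-y≡0⇒x≡y : ∀ {x y} → x - y ≡ 0# → x ≡ y
  x-y≡0⇒x≡y = x∙y⁻¹≈ε⇒x≈y _ _

  -x≡0⇒x≡0 : ∀ {x} → - x ≡ 0# → x ≡ 0#
  -x≡0⇒x≡0 {x} -x≡0 = trans (sym (-‿involutive x)) (trans (cong -_ -x≡0) -0#≈0#)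

  x+y≡z⇒x≡z-y : ∀ {x y z} → x + y ≡ z → x ≡ z - y
  x+y≡z⇒x≡z-y = x≈z//y _ _ _

  m*0+b≡b : ∀ m b → m * 0# + b ≡ b
  m*0+b≡b m b = trans (cong (_+ b) (zeroʳ m)) (+-identityˡ b)

  m*1+b≡m+b : ∀ m b → m * 1# + b ≡ m + b
  m*1+b≡m+b m b = cong (_+ b) (*-identityʳ m)

  -- slope x is the slope of the line joining the origin to (x, x − 1); pointOfSlope inverts it.
  slope : Fin q → Fin q
  slope x = 1# - x ⁻¹

  pointOfSlope : Fin q → Fin q
  pointOfSlope m = (1# - m) ⁻¹

  slope-unique : ∀ {m x} → x ≢ 0# → m * x ≡ x - 1# → m ≡ slope x
  slope-unique {m} {x} x≢0 mx≡x-1 = begin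
    m                     ≡⟨ *-identityʳ m ⟨
    m * 1#                ≡⟨ cong (m *_) (x*x⁻¹≡1 x≢0) ⟨
    m * (x * x ⁻¹)        ≡⟨ *-assoc m x (x ⁻¹) ⟨
    m * x * x ⁻¹          ≡⟨ cong (_* x ⁻¹) mx≡x-1 ⟩
    (x - 1#) * x ⁻¹       ≡⟨ [y-z]x≈yx-zx (x ⁻¹) x 1# ⟩
    x * x ⁻¹ - 1# * x ⁻¹  ≡⟨ cong₂ _-_ (x*x⁻¹≡1 x≢0) (*-identityˡ (x ⁻¹)) ⟩
    1# - x ⁻¹             ∎

  module _ {m} (m≢1 : m ≢ 1#) where

    private
      [1-m]*u≡1 : (1# - m) * pointOfSlope m ≡ 1#
      [1-m]*u≡1 = x*x⁻¹≡1 (λ 1-m≡0 → m≢1 (sym (x-y≡0⇒x≡y 1-m≡0)))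

    pointOfSlope≢0 : pointOfSlope m ≢ 0#
    pointOfSlope≢0 = x*y≡1⇒y≢0 [1-m]*u≡1

    m*pointOfSlope : m * pointOfSlope m ≡ pointOfSlope m - 1#
    m*pointOfSlope = x+y≡z⇒x≡z-y (begin
      m * u + 1#              ≡⟨ cong (m * u +_) [1-m]*u≡1 ⟨
      m * u + (1# - m) * u    ≡⟨ cong (m * u +_) ([y-z]x≈yx-zx u 1# m) ⟩
      m * u + (1# * u - m * u) ≡⟨ cong (λ v → m * u + (v - m * u)) (*-identityˡ u) ⟩
      m * u + (u - m * u)     ≡⟨ +-comm (m * u) (u - m * u) ⟩
      u - m * u + m * u       ≡⟨ //-rightDividesˡ (m * u) u ⟩
      u                       ∎)
      where
      u : Fin q
      u = pointOfSlope m

    slope-pointOfSlope : slope (pointOfSlope m) ≡ m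
    slope-pointOfSlope = sym (slope-unique pointOfSlope≢0 m*pointOfSlope)

    pointOfSlope≢1 : m ≢ 0# → pointOfSlope m ≢ 1#
    pointOfSlope≢1 m≢0 u≡1 = m≢0 (begin
      m                   ≡⟨ *-identityʳ m ⟨
      m * 1#              ≡⟨ cong (m *_) u≡1 ⟨
      m * pointOfSlope m  ≡⟨ m*pointOfSlope ⟩
      pointOfSlope m - 1# ≡⟨ cong (_- 1#) u≡1 ⟩
      1# - 1#             ≡⟨ -‿inverseʳ 1# ⟩
      0#                  ∎)

  -b*x+b≡-b*[x-1] : ∀ b x → - b * x + b ≡ - b * (x - 1#)
  -b*x+b≡-b*[x-1] b x = sym (begin
    - b * (x - 1#)         ≡⟨ x[y-z]≈xy-xz (- b) x 1# ⟩
    - b * x - - b * 1#     ≡⟨ cong (λ v → - b * x - v) (*-identityʳ (- b)) ⟩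
    - b * x - - b          ≡⟨ cong (- b * x +_) (-‿involutive b) ⟩
    - b * x + b            ∎)

  x≡-c*x⇒[1+c]*x≡0 : ∀ {c x} → x ≡ - c * x → (1# + c) * x ≡ 0#
  x≡-c*x⇒[1+c]*x≡0 {c} {x} x≡-cx = begin
    (1# + c) * x      ≡⟨ distribʳ x 1# c ⟩
    1# * x + c * x    ≡⟨ cong (_+ c * x) (trans (*-identityˡ x) x≡-cx) ⟩
    - c * x + c * x   ≡⟨ distribʳ x (- c) c ⟨
    (- c + c) * x     ≡⟨ cong (_* x) (-‿inverseˡ c) ⟩
    0# * x            ≡⟨ zeroˡ x ⟩
    0#                ∎

  [s+1]*x-1≡s*x+[x-1] : ∀ s x → (s + 1#) * x - 1# ≡ s * x + (x - 1#)
  [s+1]*x-1≡s*x+[x-1] s x = begin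
    (s + 1#) * x - 1#      ≡⟨ cong (_- 1#) (distribʳ x s 1#) ⟩
    s * x + 1# * x - 1#    ≡⟨ cong (λ v → s * x + v - 1#) (*-identityˡ x) ⟩
    s * x + x - 1#         ≡⟨ +-assoc (s * x) x (- 1#) ⟩
    s * x + (x - 1#)       ∎

  [s+1]*x≡1⇒-s*x≡x-1 : ∀ {s x} → (s + 1#) * x ≡ 1# → - s * x ≡ x - 1#
  [s+1]*x≡1⇒-s*x≡x-1 {s} {x} [s+1]x≡1 = x+y≡z⇒x≡z-y (begin
    - s * x + 1#              ≡⟨ cong (- s * x +_) [s+1]x≡1 ⟨
    - s * x + (s + 1#) * x    ≡⟨ distribʳ x (- s) (s + 1#) ⟨
    (- s + (s + 1#)) * x      ≡⟨ cong (_* x) (+-assoc (- s) s 1#) ⟨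
    (- s + s + 1#) * x        ≡⟨ cong (λ v → (v + 1#) * x) (-‿inverseˡ s) ⟩
    (0# + 1#) * x             ≡⟨ cong (_* x) (+-identityˡ 1#) ⟩
    1# * x                    ≡⟨ *-identityˡ x ⟩
    x                         ∎)

module Geometry {q : ℕ} (F : FieldOn q) where
  open AG2 F

  IsTangent : PointSet → Point → Line → Set
  IsTangent B p ℓ = p ∈L ℓ × (∀ p′ → p′ ∈L ℓ → B p′ ≡ true → p′ ≡ p)

  tangents⇒minimal : ∀ {B} → IsBlockingSet B → (∀ p → B p ≡ true → Σ Line (IsTangent B p)) →
                     IsMinimalBlockingSet B
  tangents⇒minimal blocking tangent = blocking , λ where
    S (S⊆B , p , Bp , Sp≡false) S-blocking →
      let ℓ , _ , only-p = tangent p Bp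
          p′ , p′∈ℓ , Sp′ = S-blocking ℓ
      in contradiction (trans (sym Sp′) (trans (cong S (only-p p′ p′∈ℓ (S⊆B p′ Sp′))) Sp≡false))
                       λ ()

module _ {q : ℕ} (F : FieldOn q) where

  open FieldProperties F

  record Admissible (S : Fin q → Bool) : Set where
    field
      s z            : Fin q
      S0≡false       : S 0# ≡ false
      S1≡false       : S 1# ≡ false
      Ss≡true        : S s ≡ true
      s+1≡0⊎S-s≡true : s + 1# ≡ 0# ⊎ S (- s) ≡ true
      z≢0            : z ≢ 0#
      z≢1            : z ≢ 1#
      Sz≡false       : S z ≡ false

module Construction {q : ℕ} (F : FieldOn q) (S : Fin q → Bool) (S-admissible : Admissible F S) where

  open FieldProperties F
  open Admissible S-admissible
  open AG2 F
  open Geometry F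

  f : Fin q → Fin q
  f x = if S (slope x) then x - 1# else 0#

  B : PointSet
  B (x , y) = if x == 0# then not (y == 0#)
              else if x == 1# then not (y == 0# ∨ S y)
              else y == f x

  B-column₀ : ∀ y → B (0# , y) ≡ not (y == 0#)
  B-column₀ y rewrite ==-refl 0# = refl

  B-column₁ : ∀ y → B (1# , y) ≡ not (y == 0# ∨ S y)
  B-column₁ y rewrite ==-false 1≢0 | ==-refl 1# = refl

  B-column : ∀ {x} y → x ≢ 0# → x ≢ 1# → B (x , y) ≡ y == f x
  B-column y x≢0 x≢1 rewrite ==-false x≢0 | ==-false x≢1 = refl

  data InB : Point → Set where
    column₀  : ∀ {y} → y ≢ 0# → InB (0# , y)
    column₁  : ∀ {y} → y ≢ 0# → S y ≡ false → InB (1# , y)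
    diagonal : ∀ {x} → x ≢ 0# → x ≢ 1# → S (slope x) ≡ true → InB (x , x - 1#)
    axis     : ∀ {x} → x ≢ 0# → x ≢ 1# → S (slope x) ≡ false → InB (x , 0#)

  generic : ∀ {x} → x ≢ 0# → x ≢ 1# → InB (x , f x)
  generic {x} x≢0 x≢1 with S (slope x) in S-slope
  ... | true  = diagonal x≢0 x≢1 S-slope
  ... | false = axis x≢0 x≢1 S-slope

  InB⇒B : ∀ {p} → InB p → B p ≡ true
  InB⇒B (column₀ {y} y≢0)     = trans (B-column₀ y) (cong not (==-false y≢0))
  InB⇒B (column₁ {y} y≢0 Sy)  = trans (B-column₁ y) (cong₂ (λ a b → not (a ∨ b)) (==-false y≢0) Sy)
  InB⇒B (diagonal {x} x≢0 x≢1 S-slope) = trans (B-column (x - 1#) x≢0 x≢1)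
    (trans (cong ((x - 1#) ==_) (cong (if_then x - 1# else 0#) S-slope)) (==-refl (x - 1#)))
  InB⇒B (axis {x} x≢0 x≢1 S-slope) = trans (B-column 0# x≢0 x≢1)
    (trans (cong (0# ==_) (cong (if_then x - 1# else 0#) S-slope)) (==-refl 0#))

  B⇒InB : ∀ {p} → B p ≡ true → InB p
  B⇒InB {x , y} = classify (x ≟ 0#) (x ≟ 1#)
    where
    -- A `with x ≟ 0#` here would also abstract the test hidden inside slope x = 1# - x ⁻¹.
    classify : ∀ {x y} → Dec (x ≡ 0#) → Dec (x ≡ 1#) → B (x , y) ≡ true → InB (x , y)
    classify {y = y} (yes refl) _ Bp = column₀ (==-false⇒≢ (not-injective (trans (sym (B-column₀ y)) Bp)))
    classify {y = y} (no _) (yes refl) Bp =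
      column₁ (==-false⇒≢ (∨-conicalˡ (y == 0#) (S y) y∉S₀)) (∨-conicalʳ (y == 0#) (S y) y∉S₀)
      where
      y∉S₀ : y == 0# ∨ S y ≡ false
      y∉S₀ = not-injective (trans (sym (B-column₁ y)) Bp)
    classify {x} {y} (no x≢0) (no x≢1) Bp =
      subst (λ y → InB (x , y)) (sym (==⇒≡ (trans (sym (B-column y x≢0 x≢1)) Bp))) (generic x≢0 x≢1)

  column-unique : ∀ {x y} → x ≢ 0# → x ≢ 1# → InB (x , y) → y ≡ f x
  column-unique {x} {y} x≢0 x≢1 inB = ==⇒≡ (trans (sym (B-column y x≢0 x≢1)) (InB⇒B inB))

  s≢0 : s ≢ 0#
  s≢0 refl = contradiction (trans (sym Ss≡true) S0≡false) λ ()

  MeetsOnlyAt : Line → Point → Set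
  MeetsOnlyAt ℓ p = ∀ {p′} → InB p′ → p′ ∈L ℓ → p′ ≡ p

  tangent-column₀ : ∀ {b} → b ≢ 0# → b ≢ - 1# → MeetsOnlyAt (nonVertical (- b) b) (0# , b)
  tangent-column₀ {b} _ _ (column₀ _) y≡ = cong (0# ,_) (trans y≡ (m*0+b≡b (- b) b))
  tangent-column₀ {b} _ _ (column₁ y≢0 _) y≡ =
    contradiction (trans y≡ (trans (m*1+b≡m+b (- b) b) (-‿inverseˡ b))) y≢0
  tangent-column₀ {b} _ b≢-1 (diagonal {x} _ x≢1 _) x-1≡
    with x*y≡0⇒x≡0⊎y≡0 (x≡-c*x⇒[1+c]*x≡0 (trans x-1≡ (-b*x+b≡-b*[x-1] b x)))
  ... | inj₁ 1+b≡0 = contradiction (+-inverseʳ-unique 1# b 1+b≡0) b≢-1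
  ... | inj₂ x-1≡0 = contradiction (x-y≡0⇒x≡y x-1≡0) x≢1
  tangent-column₀ {b} b≢0 _ (axis {x} _ x≢1 _) 0≡
    with x*y≡0⇒x≡0⊎y≡0 (sym (trans 0≡ (-b*x+b≡-b*[x-1] b x)))
  ... | inj₁ -b≡0    = contradiction (-x≡0⇒x≡0 -b≡0) b≢0
  ... | inj₂ x-1≡0   = contradiction (x-y≡0⇒x≡y x-1≡0) x≢1

  tangent-column₀-at-−1 : MeetsOnlyAt (nonVertical (s + 1#) (- 1#)) (0# , - 1#)
  tangent-column₀-at-−1 (column₀ _) y≡ = cong (0# ,_) (trans y≡ (m*0+b≡b (s + 1#) (- 1#)))
  tangent-column₀-at-−1 (column₁ {y} _ Sy≡false) y≡ =
    contradiction (trans (sym Ss≡true) (trans (cong S (sym y≡s)) Sy≡false)) λ ()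
    where
    y≡s : y ≡ s
    y≡s = trans y≡ (trans (m*1+b≡m+b (s + 1#) (- 1#)) (//-rightDividesʳ 1# s))
  tangent-column₀-at-−1 (diagonal {x} x≢0 _ _) x-1≡
    with x*y≡0⇒x≡0⊎y≡0
           (+-identityˡ-unique (s * x) (x - 1#) (sym (trans x-1≡ ([s+1]*x-1≡s*x+[x-1] s x))))
  ... | inj₁ s≡0 = contradiction s≡0 s≢0
  ... | inj₂ x≡0 = contradiction x≡0 x≢0
  tangent-column₀-at-−1 (axis {x} x≢0 _ S-slope≡false) 0≡ =
    contradiction (x-y≡0⇒x≡y (sym 0≡)) (not-inverse s+1≡0⊎S-s≡true)
    where
    not-inverse : s + 1# ≡ 0# ⊎ S (- s) ≡ true → (s + 1#) * x ≢ 1#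
    not-inverse (inj₁ s+1≡0) [s+1]x≡1 =
      0≢1 (trans (sym (zeroˡ x)) (trans (cong (_* x) (sym s+1≡0)) [s+1]x≡1))
    not-inverse (inj₂ S-s≡true) [s+1]x≡1 =
      contradiction (trans (sym S-s≡true) (trans (cong S -s≡slope) S-slope≡false)) λ ()
      where
      -s≡slope : - s ≡ slope x
      -s≡slope = slope-unique x≢0 ([s+1]*x≡1⇒-s*x≡x-1 [s+1]x≡1)

  tangent-column₁ : ∀ {y} → y ≢ 0# → S y ≡ false → MeetsOnlyAt (nonVertical y 0#) (1# , y)
  tangent-column₁ {y} y≢0 _ (column₀ y′≢0) y′≡ = contradiction (trans y′≡ (m*0+b≡b y 0#)) y′≢0
  tangent-column₁ {y} _ _ (column₁ _ _) y′≡ =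
    cong (1# ,_) (trans y′≡ (trans (m*1+b≡m+b y 0#) (+-identityʳ y)))
  tangent-column₁ {y} _ Sy≡false (diagonal {x} x≢0 _ S-slope≡true) x-1≡ =
    contradiction (trans (sym Sy≡false) (trans (cong S y≡slope) S-slope≡true)) λ ()
    where
    y≡slope : y ≡ slope x
    y≡slope = slope-unique x≢0 (sym (trans x-1≡ (+-identityʳ (y * x))))
  tangent-column₁ {y} y≢0 _ (axis {x} x≢0 _ _) 0≡
    with x*y≡0⇒x≡0⊎y≡0 (sym (trans 0≡ (+-identityʳ (y * x))))
  ... | inj₁ y≡0 = contradiction y≡0 y≢0
  ... | inj₂ x≡0 = contradiction x≡0 x≢0

  tangent-vertical : ∀ {x y} → x ≢ 0# → x ≢ 1# → InB (x , y) → MeetsOnlyAt (vertical x) (x , y)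
  tangent-vertical {x} x≢0 x≢1 inB {x , y′} inB′ refl =
    cong (x ,_) (trans (column-unique x≢0 x≢1 inB′) (sym (column-unique x≢0 x≢1 inB)))

  tangentVia : ∀ {p} ℓ → p ∈L ℓ → MeetsOnlyAt ℓ p → Σ Line (IsTangent B p)
  tangentVia ℓ p∈ℓ only-p = ℓ , p∈ℓ , λ p′ p′∈ℓ Bp′ → only-p (B⇒InB Bp′) p′∈ℓ

  tangent : ∀ {p} → InB p → Σ Line (IsTangent B p)
  tangent (column₀ {b} b≢0) with b ≟ - 1#
  ... | yes refl = tangentVia (nonVertical (s + 1#) (- 1#)) (sym (m*0+b≡b (s + 1#) (- 1#)))
                              tangent-column₀-at-−1
  ... | no b≢-1  = tangentVia (nonVertical (- b) b) (sym (m*0+b≡b (- b) b)) (tangent-column₀ b≢0 b≢-1)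
  tangent (column₁ {y} y≢0 Sy≡false) =
    tangentVia (nonVertical y 0#) (sym (trans (m*1+b≡m+b y 0#) (+-identityʳ y))) (tangent-column₁ y≢0 Sy≡false)
  tangent inB@(diagonal x≢0 x≢1 _) = tangentVia (vertical _) refl (tangent-vertical x≢0 x≢1 inB)
  tangent inB@(axis x≢0 x≢1 _)     = tangentVia (vertical _) refl (tangent-vertical x≢0 x≢1 inB)

  blockingPoint : ∀ ℓ → Σ Point λ p → p ∈L ℓ × InB p
  blockingPoint (vertical c) with c ≟ 0# | c ≟ 1#
  ... | yes refl | _        = (0# , 1#) , refl , column₀ 1≢0
  ... | no _     | yes refl = (1# , 1#) , refl , column₁ 1≢0 S1≡false
  ... | no c≢0   | no c≢1   = (c , f c) , refl , generic c≢0 c≢1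
  blockingPoint (nonVertical m b) with b ≟ 0#
  ... | no b≢0 = (0# , b) , sym (m*0+b≡b m b) , column₀ b≢0
  ... | yes refl with m ≟ 0#
  ...   | yes refl = (u , 0#) , sym (trans (+-identityʳ (0# * u)) (zeroˡ u)) ,
                     axis (pointOfSlope≢0 z≢1) (pointOfSlope≢1 z≢1 z≢0)
                          (trans (cong S (slope-pointOfSlope z≢1)) Sz≡false)
    where
    u : Fin q
    u = pointOfSlope z
  ...   | no m≢0 with S m in Sm
  ...     | false = (1# , m) , sym (trans (m*1+b≡m+b m 0#) (+-identityʳ m)) , column₁ m≢0 Sm
  ...     | true  = (u , u - 1#) , sym (trans (+-identityʳ (m * u)) (m*pointOfSlope m≢1)) ,
                    diagonal (pointOfSlope≢0 m≢1) (pointOfSlope≢1 m≢1 m≢0)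
                             (trans (cong S (slope-pointOfSlope m≢1)) Sm)
    where
    u : Fin q
    u = pointOfSlope m
    m≢1 : m ≢ 1#
    m≢1 refl = contradiction (trans (sym Sm) S1≡false) λ ()

  blocking : IsBlockingSet B
  blocking ℓ with blockingPoint ℓ
  ... | p , p∈ℓ , inB = p , p∈ℓ , InB⇒B inB

  minimal : IsMinimalBlockingSet B
  minimal = tangents⇒minimal blocking (λ p Bp → tangent (B⇒InB Bp))

  size-B : size B +ℕ count S +ℕ 4 ≡ 3 *ℕ q
  size-B = size-arithmetic (trans (cong (_+ℕ 2) (count-cartesianProduct B)) column-sum)
                           column₀-count column₁-count
    where
    columnCount : Fin q → ℕ
    columnCount x = count (λ y → B (x , y))

    column₀-count : columnCount 0# +ℕ 1 ≡ q
    column₀-count = trans (cong₂ _+ℕ_ (count-cong B-column₀) (sym (count-== 0#))) (count-not (_== 0#))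

    disjoint : ∀ y → (y == 0#) ∧ S y ≡ false
    disjoint y with y ≟ 0#
    ... | yes refl = S0≡false
    ... | no _     = refl

    column₁-count : columnCount 1# +ℕ (1 +ℕ count S) ≡ q
    column₁-count = begin
      columnCount 1# +ℕ (1 +ℕ count S)
        ≡⟨ cong₂ _+ℕ_ (count-cong B-column₁) (cong (_+ℕ count S) (sym (count-== 0#))) ⟩
      count (λ y → not (y == 0# ∨ S y)) +ℕ (count (_== 0#) +ℕ count S)
        ≡⟨ cong (count (λ y → not (y == 0# ∨ S y)) +ℕ_) (count-∨-disjoint (_== 0#) S disjoint) ⟨
      count (λ y → not (y == 0# ∨ S y)) +ℕ count (λ y → y == 0# ∨ S y)
        ≡⟨ count-not (λ y → y == 0# ∨ S y) ⟩
      q ∎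
      where open ≡-Reasoning

    generic-count : ∀ x → x ≢ 0# → x ≢ 1# → columnCount x ≡ 1
    generic-count x x≢0 x≢1 = trans (count-cong (λ y → B-column y x≢0 x≢1)) (count-== (f x))

    column-sum : sum columnCount +ℕ 2 ≡ columnCount 0# +ℕ columnCount 1# +ℕ q
    column-sum = ∑-two-exceptions columnCount 0≢1 generic-count

    size-arithmetic : ∀ {C c₀ c₁ n} → C +ℕ 2 ≡ c₀ +ℕ c₁ +ℕ q → c₀ +ℕ 1 ≡ q → c₁ +ℕ (1 +ℕ n) ≡ q →
                      C +ℕ n +ℕ 4 ≡ 3 *ℕ q
    size-arithmetic {C} {c₀} {c₁} {n} C+2≡ c₀+1≡q c₁+1+n≡q = begin
      C +ℕ n +ℕ 4                              ≡⟨ regroup₁ C n ⟩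
      (C +ℕ 2) +ℕ (n +ℕ 2)                     ≡⟨ cong (_+ℕ (n +ℕ 2)) C+2≡ ⟩
      c₀ +ℕ c₁ +ℕ q +ℕ (n +ℕ 2)                ≡⟨ regroup₂ c₀ c₁ q n ⟩
      (c₀ +ℕ 1) +ℕ (c₁ +ℕ (1 +ℕ n)) +ℕ q       ≡⟨ cong (_+ℕ q) (cong₂ _+ℕ_ c₀+1≡q c₁+1+n≡q) ⟩
      q +ℕ q +ℕ q                              ≡⟨ regroup₃ q ⟩
      3 *ℕ q                                   ∎
      where
      open ≡-Reasoning
      regroup₁ : ∀ C n → C +ℕ n +ℕ 4 ≡ (C +ℕ 2) +ℕ (n +ℕ 2)
      regroup₁ = solve-∀
      regroup₂ : ∀ c₀ c₁ q n →
                 c₀ +ℕ c₁ +ℕ q +ℕ (n +ℕ 2) ≡ (c₀ +ℕ 1) +ℕ (c₁ +ℕ (1 +ℕ n)) +ℕ q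
      regroup₂ = solve-∀
      regroup₃ : ∀ q → q +ℕ q +ℕ q ≡ 3 *ℕ q
      regroup₃ = solve-∀

module _ {q : ℕ} (F : FieldOn q) where

  open FieldProperties F

  special-elements : 4 ≤ q → ∃₂ λ s z → s ≢ 0# × s ≢ 1# × z ≢ 0# × z ≢ 1# × z ≢ s ×
                                         (s + 1# ≡ 0# ⊎ - s ≡ s)
  special-elements 4≤q with - 1# ≟ 1# | ∃-avoiding-three 4≤q 0# 1# (- 1#)
  ... | no -1≢1 | z , z≢0 , z≢1 , z≢-1 =
    - 1# , z , -1≢0 , -1≢1 , z≢0 , z≢1 , z≢-1 , inj₁ (-‿inverseˡ 1#)
    where
    -1≢0 : - 1# ≢ 0#
    -1≢0 -1≡0 = 1≢0 (-x≡0⇒x≡0 -1≡0)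
  ... | yes -1≡1 | _ with ∃-avoiding-three 4≤q 0# 1# 1#
  ... | s , s≢0 , s≢1 , _ with ∃-avoiding-three 4≤q 0# 1# s
  ... | z , z≢0 , z≢1 , z≢s = s , z , s≢0 , s≢1 , z≢0 , z≢1 , z≢s , inj₂ -s≡s
    where
    -s≡s : - s ≡ s
    -s≡s = trans (sym (-1*x≈-x s)) (trans (cong (_* s) -1≡1) (*-identityˡ s))

  module SlopeSegments {s z : Fin q} (s≢0 : s ≢ 0#) (s≢1 : s ≢ 1#)
                       (z≢0 : z ≢ 0#) (z≢1 : z ≢ 1#) (z≢s : z ≢ s)
                       (s+1≡0⊎-s≡s : s + 1# ≡ 0# ⊎ - s ≡ s) where

    open Segments ∈｛ 0# , 1# , z ｝ s public

    s∉｛0,1,z｝ : ∈｛ 0# , 1# , z ｝ s ≡ false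
    s∉｛0,1,z｝ = ∉｛｝ s≢0 s≢1 (z≢s ∘ sym)

    segment-admissible : ∀ t → Admissible F (segment t)
    segment-admissible t = record
      { s              = s
      ; z              = z
      ; S0≡false       = segment-∉ t 0# (∈｛｝-first 0# 1# z)
      ; S1≡false       = segment-∉ t 1# (∈｛｝-second 0# 1# z)
      ; Ss≡true        = segment-∋s t s∉｛0,1,z｝
      ; s+1≡0⊎S-s≡true = map₂ (λ -s≡s → trans (cong (segment t) -s≡s) (segment-∋s t s∉｛0,1,z｝))
                              s+1≡0⊎-s≡s
      ; z≢0            = z≢0
      ; z≢1            = z≢1
      ; Sz≡false       = segment-∉ t z (∈｛｝-third 0# 1# z)
      }

    segment-of-size : ∀ {n} → 1 ≤ n → n +ℕ 3 ≤ q → ∃ λ t → count (segment t) ≡ n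
    segment-of-size 1≤n n+3≤q =
      intermediateValue (λ t → count (segment t)) count-segment-suc q
        (subst (_≤ _) (sym (count-segment-zero s∉｛0,1,z｝)) 1≤n)
        (+-cancelʳ-≤ 3 _ _ (subst (_ +ℕ 3 ≤_) (sym full) n+3≤q))
      where
      full : count (segment q) +ℕ 3 ≡ q
      full = trans (cong (count (segment q) +ℕ_) (sym (count-∈｛｝ 0≢1 (z≢0 ∘ sym) (z≢1 ∘ sym))))
                   count-segment-n

  admissible-of-size : 4 ≤ q → ∀ {n} → 1 ≤ n → n +ℕ 3 ≤ q → ∃ λ S → Admissible F S × count S ≡ n
  admissible-of-size 4≤q 1≤n n+3≤q =
    let s , z , s≢0 , s≢1 , z≢0 , z≢1 , z≢s , s-condition = special-elements 4≤q
        open SlopeSegments s≢0 s≢1 z≢0 z≢1 z≢s s-condition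
        t , count≡n = segment-of-size 1≤n n+3≤q
    in segment t , segment-admissible t , count≡n

open import Data.Nat using (_*_; _∸_)

theorem4p5 : (q : ℕ) → IsPrimePower q → 5 ≤ q → (F : FieldOn q) →
    (k : ℕ) → 2 * q ∸ 1 ≤ k → k ≤ 3 * q ∸ 6 →
    Σ (AG2.PointSet F) λ B → AG2.IsMinimalBlockingSet F B × (AG2.size F B ≡ k)
theorem4p5 q _ 5≤q F k lo hi =
  let n , 1≤n , n+3≤q , k+n+4≡3q = sizeParameter 5≤q lo hi
      S , S-admissible , count≡n = admissible-of-size F (<⇒≤ 5≤q) 1≤n n+3≤q
      open Construction F S S-admissible
      size+n+4≡k+n+4 : AG2.size F B +ℕ n +ℕ 4 ≡ k +ℕ n +ℕ 4
      size+n+4≡k+n+4 = trans (cong (λ c → AG2.size F B +ℕ c +ℕ 4) (sym count≡n))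
                             (trans size-B (sym k+n+4≡3q))
  in B , minimal , +-cancelʳ-≡ n _ _ (+-cancelʳ-≡ 4 _ _ size+n+4≡k+n+4)
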